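{- Let $n\ge1$, $m\ge1$. Every geodesic between any vertex $v$ of the dYoke graph $Z_{n,m}$ and $0$ (from $v$ to $0$) is a pivot path.
   Context: Elements of $\mathbb{Z}_n$ are identified with their smallest nonnegative representatives in $\{0,\dots,n-1\}$. The dYoke graph $Z_{n,m}$ has as vertices all tuples $u=(u_0,\dots,u_{m+1})$ with $u_0,u_{m+1}\in\mathbb{Z}_n$, $u_1,\dots,u_m\in\{ -1,0,1\}$ and $\sum_{i=0}^{m+1}u_i\equiv0\pmod n$; adjacency: there is $0\le i\le m$ with $u_j=v_j$ for $j\notin\{i,i+1\}$ and either ($u_i=v_i+1$, $u_{i+1}=v_{i+1}-1$) or ($u_i=v_i-1$, $u_{i+1}=v_{i+1}+1$), arithmetic in coordinates $0,m+1$ in $\mathbb{Z}_n$. $0$ is the all-zero vertex. For $0\le i\le m$, $\overleftarrow{s}_i(v)$ is obtained from $v$ by adding $1$ to entry $i$ and subtracting $1$ from entry $i+1$ if the result is a vertex (and is $v$ otherwise); $\overrightarrow{s}_i(v)$ subtracts $1$ from entry $i$ and adds $1$ to entry $i+1$. The word of a path $v^0\sim\dots\sim v^d$ is $f_d\cdots f_1$ with $f_t(v^{t-1})=v^t$. For a path $P$ from $v$ to $0$ with word $w$: $0\le p\le m$ is an inner wall if neither $\overleftarrow{s}_p$ nor $\overrightarrow{s}_p$ occurs in $w$; $-1$ is a wall if $\overleftarrow{s}_0$ does not occur in $w$; $m+1$ is a wall if $\overrightarrow{s}_m$ does not occur in $w$. A $p$-pivot path of $v$ is a shortest path among all paths from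 $v$ to $0$ having $p$ as a wall; a pivot path is a $p$-pivot path for some $p$. -}

module Defs where

open import Data.Nat using (ℕ; zero; suc; _≤_; _≟_)
open import Data.Fin using (Fin; toℕ; fromℕ)
import Data.Fin as Fin
open import Data.Integer using (ℤ; +_; -_; _+_; _-_; _<_) renaming (_≤_ to _≤ℤ_)
open import Data.Integer.Divisibility using () renaming (_∣_ to _∣ℤ_)
open import Data.Vec using (Vec; lookup; foldr; replicate)
open import Data.List using (List; []; _∷_; length)
open import Data.List.Membership.Propositional using (_∈_)
open import Data.Product using (_×_; _,_; Σ; ∃)
open import Data.Sum using (_⊎_)
open import Relation.Nullary using (¬_; yes; no)
open import Relation.Binary.PropositionalEquality using (_≡_; _≢_)

-- A tuple u = (u_0, ..., u_{m+1}) of integers (entries 0 and m+1 are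
-- representatives in {0,...,n-1} of elements of ℤ_n).
Tuple : ℕ → Set
Tuple m = Vec ℤ (suc (suc m))

Boundary : (m : ℕ) → Fin (suc (suc m)) → Set
Boundary m j = (toℕ j ≡ 0) ⊎ (toℕ j ≡ suc m)

sumℤ : ∀ {k} → Vec ℤ k → ℤ
sumℤ = foldr _ _+_ (+ 0)

record IsVertex (n m : ℕ) (u : Tuple m) : Set where
  field
    boundaryRange : ∀ j → Boundary m j → (+ 0 ≤ℤ lookup u j) × (lookup u j < + n)
    innerRange    : ∀ j → ¬ Boundary m j →
                    (lookup u j ≡ - (+ 1)) ⊎ (lookup u j ≡ + 0) ⊎ (lookup u j ≡ + 1)
    sumZero       : (+ n) ∣ℤ sumℤ u

zeroV : (m : ℕ) → Tuple m
zeroV m = replicate _ (+ 0)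

-- direction: ←s_i (add 1 at i, subtract 1 at i+1) or →s_i (the opposite)
data Dir : Set where
  L R : Dir

Gen : ℕ → Set
Gen m = Fin (suc m) × Dir

sgnAt : Dir → ℤ
sgnAt L = + 1
sgnAt R = - (+ 1)

sgnNext : Dir → ℤ
sgnNext L = - (+ 1)
sgnNext R = + 1

delta : ∀ {m} → Gen m → Fin (suc (suc m)) → ℤ
delta (i , d) j with toℕ j ≟ toℕ i | toℕ j ≟ suc (toℕ i)
... | yes _ | _ = sgnAt d
... | no _ | yes _ = sgnNext d
... | no _ | no _ = + 0

EqAt : (n m : ℕ) → Fin (suc (suc m)) → ℤ → ℤ → Set
EqAt n m j a b = (Boundary m j × (+ n) ∣ℤ (a - b)) ⊎ (¬ Boundary m j × a ≡ b)

record Move (n m : ℕ) (g : Gen m) (u u' : Tuple m) : Set where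
  field
    srcVertex : IsVertex n m u
    tgtVertex : IsVertex n m u'
    shift     : ∀ j → EqAt n m j (lookup u' j) (lookup u j + delta g j)

data Path (n m : ℕ) : Tuple m → Tuple m → Set where
  []   : ∀ {u} → Path n m u u
  step : ∀ {u u' w} (g : Gen m) → Move n m g u u' → Path n m u' w → Path n m u w

len : ∀ {n m u w} → Path n m u w → ℕ
len [] = 0
len (step _ _ P) = suc (len P)

word : ∀ {n m u w} → Path n m u w → List (Gen m)
word [] = []
word (step g _ P) = g ∷ word P

data WallPos (m : ℕ) : Set where
  minus1 : WallPos m
  inner  : Fin (suc m) → WallPos m
  mplus1 : WallPos m

IsWall : ∀ {n m u w} → Path n m u w → WallPos m → Set
IsWall P minus1 = ¬ ((Fin.zero , L) ∈ word P)
IsWall {m = m} P mplus1 = ¬ ((fromℕ m , R) ∈ word P)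
IsWall P (inner p) = ¬ ((p , L) ∈ word P) × ¬ ((p , R) ∈ word P)

IsPPivot : ∀ {n m v} → Path n m v (zeroV m) → WallPos m → Set
IsPPivot {n} {m} {v} P p =
  IsWall P p × (∀ (Q : Path n m v (zeroV m)) → IsWall Q p → len P ≤ len Q)

IsPivot : ∀ {n m v} → Path n m v (zeroV m) → Set
IsPivot {m = m} P = Σ (WallPos m) (IsPPivot P)

IsGeodesic : ∀ {n m v} → Path n m v (zeroV m) → Set
IsGeodesic {n} {m} {v} P = ∀ (Q : Path n m v (zeroV m)) → len P ≤ len Q

module Submission where

-- A geodesic is shortest among all paths from v to 0, hence among those with
-- any prescribed wall; so it suffices to show that every geodesic has a wall.
-- This is a flow argument.  The net flow c_P(k) of a path P across the edge
-- k (0 ≤ k ≤ m) is #(←s_k in P) − #(→s_k in P); it satisfies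
-- u_j + c(j) − c(j−1) ≡ 0 at every coordinate j (mod n at the boundary).
-- Conversely, every vertex u carrying such a flow c has a path to 0 of
-- length Σ_k |c(k)|: repeatedly apply, at an edge where |c(k)| is maximal,
-- the generator that decreases |c(k)|; maximality keeps the inner coordinates
-- in {−1,0,1}.  So a geodesic never uses both ←s_k and →s_k.  If ←s_0 or →s_m
-- is unused, −1 resp. m+1 is a wall.  Otherwise c_P(0) > 0 > c_P(m), and
-- c_P changes by −v_j ∈ {−1,0,1} between consecutive edges, so c_P(k) = 0 for
-- some edge k, which is then an inner wall.

open import Defs
open import Data.Nat as ℕ using (ℕ; zero; suc; z≤n; s≤s; _≤_; _<_; NonZero; >-nonZero)
import Data.Nat.Properties as ℕP
import Data.Nat.Divisibility as ℕD
open import Data.Integer as ℤ using (ℤ; +_; -[1+_]; -_; _+_; _-_; _*_; _⊖_; ∣_∣; +[1+_])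
import Data.Integer.Properties as ℤP
import Data.Integer.Divisibility as ℤD
import Data.Integer.Divisibility.Signed as ℤS
open import Data.Integer.DivMod using (_%ℕ_; _/ℕ_; a≡a%ℕn+[a/ℕn]*n; n%ℕd<d)
open import Data.Integer.Tactic.RingSolver using (solve-∀)
open import Data.Fin as F using (Fin; toℕ)
import Data.Fin.Properties as FP
open import Data.Vec using (Vec; []; _∷_; lookup; tabulate)
import Data.Vec.Properties as VP
open import Data.List.Membership.Propositional using (_∈_)
open import Data.List.Relation.Unary.Any using (here; there)
open import Data.Product using (Σ; ∃-syntax; _×_; _,_; proj₁; proj₂)
open import Data.Sum using (_⊎_; inj₁; inj₂; swap; map; map₁)
open import Data.Empty using (⊥-elim)
open import Function using (_∘_)
open import Relation.Nullary using (¬_; Dec; yes; no)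
open import Relation.Nullary.Decidable using (_⊎-dec_)
open import Relation.Binary.PropositionalEquality

adjust : {A : Set} → (ℕ → A) → ℕ → (A → A) → ℕ → A
adjust f i g k with k ℕ.≟ i
... | yes _ = g (f k)
... | no _  = f k

adjust-here : ∀ {A : Set} (f : ℕ → A) i g → adjust f i g i ≡ g (f i)
adjust-here f i g with i ℕ.≟ i
... | yes _  = refl
... | no i≢i = ⊥-elim (i≢i refl)

adjust-there : ∀ {A : Set} (f : ℕ → A) i g {k} → k ≢ i → adjust f i g k ≡ f k
adjust-there f i g {k} k≢i with k ℕ.≟ i
... | yes k≡i = ⊥-elim (k≢i k≡i)
... | no _    = refl

sumBelow : ℕ → (ℕ → ℕ) → ℕ
sumBelow zero    f = 0
sumBelow (suc K) f = f 0 ℕ.+ sumBelow K (f ∘ suc)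

sumBelow-cong : ∀ K {f g : ℕ → ℕ} → (∀ k → f k ≡ g k) → sumBelow K f ≡ sumBelow K g
sumBelow-cong zero    f≗g = refl
sumBelow-cong (suc K) f≗g = cong₂ ℕ._+_ (f≗g 0) (sumBelow-cong K (f≗g ∘ suc))

sumBelow-zero : ∀ K f → (∀ k → k < K → f k ≡ 0) → sumBelow K f ≡ 0
sumBelow-zero zero    f _  = refl
sumBelow-zero (suc K) f f≡0 =
  cong₂ ℕ._+_ (f≡0 0 (s≤s z≤n))
              (sumBelow-zero K (f ∘ suc) (λ k k<K → f≡0 (suc k) (s≤s k<K)))

sumBelow≡0 : ∀ K f → sumBelow K f ≡ 0 → ∀ k → k < K → f k ≡ 0
sumBelow≡0 (suc K) f Σ≡0 zero    _         = ℕP.m+n≡0⇒m≡0 (f 0) Σ≡0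
sumBelow≡0 (suc K) f Σ≡0 (suc k) (s≤s k<K) =
  sumBelow≡0 K (f ∘ suc) (ℕP.m+n≡0⇒n≡0 (f 0) Σ≡0) k k<K

sumBelow-bump : ∀ K f g i → i < K → g i ≡ suc (f i) → (∀ k → k ≢ i → g k ≡ f k) →
                sumBelow K g ≡ suc (sumBelow K f)
sumBelow-bump (suc K) f g zero _ gi others =
  cong₂ ℕ._+_ gi (sumBelow-cong K (λ k → others (suc k) λ ()))
sumBelow-bump (suc K) f g (suc i) (s≤s i<K) gi others =
  trans (cong₂ ℕ._+_ (others 0 λ ())
                     (sumBelow-bump K (f ∘ suc) (g ∘ suc) i i<K gi
                        (λ k k≢i → others (suc k) (k≢i ∘ ℕP.suc-injective))))
        (ℕP.+-suc (f 0) _)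

sumBelow-mono : ∀ K f g → (∀ k → f k ≤ g k) → sumBelow K f ≤ sumBelow K g
sumBelow-mono zero    f g f≤g = z≤n
sumBelow-mono (suc K) f g f≤g =
  ℕP.+-mono-≤ (f≤g 0) (sumBelow-mono K (f ∘ suc) (g ∘ suc) (f≤g ∘ suc))

sumBelow-strict : ∀ K f g i → i < K → f i < g i → (∀ k → f k ≤ g k) →
                  sumBelow K f < sumBelow K g
sumBelow-strict (suc K) f g zero _ fi<gi f≤g =
  ℕP.+-mono-<-≤ fi<gi (sumBelow-mono K (f ∘ suc) (g ∘ suc) (f≤g ∘ suc))
sumBelow-strict (suc K) f g (suc i) (s≤s i<K) fi<gi f≤g =
  ℕP.+-mono-≤-< (f≤g 0) (sumBelow-strict K (f ∘ suc) (g ∘ suc) i i<K fi<gi (f≤g ∘ suc))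

argmax : (f : ℕ → ℕ) (m : ℕ) → Σ (Fin (suc m)) λ i → ∀ k → k ≤ m → f k ≤ f (toℕ i)
argmax f zero = F.zero , λ { zero _ → ℕP.≤-refl }
argmax f (suc m) with argmax f m
... | i , below with f (suc m) ℕ.≤? f (toℕ i)
...   | yes last≤ = F.inject₁ i , λ k k≤ →
          subst (λ t → f k ≤ f t) (sym (FP.toℕ-inject₁ i)) (bounded k k≤)
  where
  bounded : ∀ k → k ≤ suc m → f k ≤ f (toℕ i)
  bounded k k≤ with ℕP.m≤n⇒m<n∨m≡n k≤
  ... | inj₁ k<  = below k (ℕP.≤-pred k<)
  ... | inj₂ refl = last≤
...   | no last≰ = F.fromℕ (suc m) , λ k k≤ →
          subst (λ t → f k ≤ f t) (sym (FP.toℕ-fromℕ (suc m))) (bounded k k≤)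
  where
  bounded : ∀ k → k ≤ suc m → f k ≤ f (suc m)
  bounded k k≤ with ℕP.m≤n⇒m<n∨m≡n k≤
  ... | inj₁ k<  = ℕP.≤-trans (below k (ℕP.≤-pred k<)) (ℕP.<⇒≤ (ℕP.≰⇒> last≰))
  ... | inj₂ refl = ℕP.≤-refl

tally : Dir → Dir → (ℕ → ℕ) → ℕ → ℕ → ℕ
tally L L f i = adjust f i suc
tally R R f i = adjust f i suc
tally L R f i = f
tally R L f i = f

tally-same : ∀ d f i → tally d d f i i ≡ suc (f i)
tally-same L f i = adjust-here f i suc
tally-same R f i = adjust-here f i suc

tally-there : ∀ d' d f i {k} → k ≢ i → tally d' d f i k ≡ f k
tally-there L L f i k≢i = adjust-there f i suc k≢i
tally-there R R f i k≢i = adjust-there f i suc k≢i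
tally-there L R f i k≢i = refl
tally-there R L f i k≢i = refl

tally-mono : ∀ d' d f i k → f k ≤ tally d' d f i k
tally-mono d' d f i k with k ℕ.≟ i
... | no k≢i  = ℕP.≤-reflexive (sym (tally-there d' d f i k≢i))
... | yes refl = tally-at d' d
  where
  tally-at : ∀ d' d → f k ≤ tally d' d f k k
  tally-at L L = ℕP.≤-trans (ℕP.n≤1+n (f k)) (ℕP.≤-reflexive (sym (tally-same L f k)))
  tally-at R R = ℕP.≤-trans (ℕP.n≤1+n (f k)) (ℕP.≤-reflexive (sym (tally-same R f k)))
  tally-at L R = ℕP.≤-refl
  tally-at R L = ℕP.≤-refl

Trit : ℤ → Set
Trit x = (x ≡ - (+ 1)) ⊎ (x ≡ + 0) ⊎ (x ≡ + 1)

trit-neg : ∀ {x} → Trit x → Trit (- x)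
trit-neg (inj₁ refl)        = inj₂ (inj₂ refl)
trit-neg (inj₂ (inj₁ refl)) = inj₂ (inj₁ refl)
trit-neg (inj₂ (inj₂ refl)) = inj₁ refl

trit-push : ∀ d {x} → Trit x → x ≢ sgnAt d → Trit (x + sgnAt d)
trit-push L (inj₁ refl)        _    = inj₂ (inj₁ refl)
trit-push L (inj₂ (inj₁ refl)) _    = inj₂ (inj₂ refl)
trit-push L (inj₂ (inj₂ refl)) x≢s  = ⊥-elim (x≢s refl)
trit-push R (inj₁ refl)        x≢s  = ⊥-elim (x≢s refl)
trit-push R (inj₂ (inj₁ refl)) _    = inj₁ refl
trit-push R (inj₂ (inj₂ refl)) _    = inj₂ (inj₁ refl)

reverse : Dir → Dir
reverse L = R
reverse R = L

sgnNext≡sgnAt-reverse : ∀ d → sgnNext d ≡ sgnAt (reverse d)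
sgnNext≡sgnAt-reverse L = refl
sgnNext≡sgnAt-reverse R = refl

minus-reverse : ∀ d z → z - sgnAt (reverse d) ≡ z + sgnAt d
minus-reverse L z = refl
minus-reverse R z = refl

-- Oriented d a x : x = ±(a+1), with the sign of sgnAt d.  Applying the
-- generator (i , d) decreases the flow at an edge i with Oriented d a (c i).
data Oriented : Dir → ℕ → ℤ → Set where
  up   : ∀ a → Oriented L a (+ suc a)
  down : ∀ a → Oriented R a -[1+ a ]

orient : ∀ x → x ≡ + 0 ⊎ Σ Dir λ d → Σ ℕ λ a → Oriented d a x
orient (+ zero)  = inj₁ refl
orient +[1+ a ]  = inj₂ (L , a , up a)
orient -[1+ a ]  = inj₂ (R , a , down a)

oriented-size : ∀ {d a x} → Oriented d a x → ∣ x ∣ ≡ suc a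
oriented-size (up a)   = refl
oriented-size (down a) = refl

oriented-toward : ∀ {d a x} → Oriented d a x → ∣ x ∣ ≡ suc ∣ x - sgnAt d ∣
oriented-toward (up a)   = refl
oriented-toward (down a) = cong suc (sym (ℤP.∣m⊖n∣≡∣n⊖m∣ 1 (suc a)))

overshoot : ∀ {d a x y} → Oriented d a x → ∣ y ∣ ≤ suc a → y ≢ x + sgnAt d
overshoot (up a)   bound refl = ℕP.m+1+n≰m (suc a) bound
overshoot (down a) bound refl =
  ℕP.<-irrefl refl (subst (λ t → suc (suc t) ≤ suc a) (ℕP.+-identityʳ a) bound)

balance-left : ∀ {x y z} → + 0 ≡ x + (y - z) → z ≡ y + x
balance-left {x} {y} {z} eq = begin
  z                       ≡⟨ identity x y z ⟩
  (y + x) - (x + (y - z)) ≡⟨ cong (λ t → (y + x) - t) (sym eq) ⟩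
  (y + x) - + 0           ≡⟨ ℤP.+-identityʳ (y + x) ⟩
  y + x                   ∎
  where
  open ≡-Reasoning
  identity : ∀ x y z → z ≡ (y + x) - (x + (y - z))
  identity = solve-∀

balance-right : ∀ {x y z} → + 0 ≡ x + (y - z) → y ≡ z - x
balance-right {x} {y} {z} eq = begin
  y                       ≡⟨ identity x y z ⟩
  (x + (y - z)) + (z - x) ≡⟨ cong (_+ (z - x)) (sym eq) ⟩
  + 0 + (z - x)           ≡⟨ ℤP.+-identityˡ (z - x) ⟩
  z - x                   ∎
  where
  open ≡-Reasoning
  identity : ∀ x y z → y ≡ (x + (y - z)) + (z - x)
  identity = solve-∀

-- the inner coordinate at the source i of a flow-decreasing move stays a trit:
-- there x = z − y with y = c(i) oriented and |z| = |c(i−1)| ≤ |c(i)|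
push-at-source : ∀ {d a x y z} → Trit x → Oriented d a y → ∣ z ∣ ≤ suc a →
                 + 0 ≡ x + (y - z) → Trit (x + sgnAt d)
push-at-source {d} {x = x} {y} {z} tx peak bound eq =
  trit-push d tx λ x≡s →
    overshoot {y = z} peak bound (trans (balance-left {x} {y} {z} eq) (cong (λ t → y + t) x≡s))

-- likewise at the target i+1: there x = z − y with z = c(i) oriented, |y| ≤ |c(i)|
push-at-target : ∀ {d a x y z} → Trit x → Oriented d a z → ∣ y ∣ ≤ suc a →
                 + 0 ≡ x + (y - z) → Trit (x + sgnNext d)
push-at-target {d} {x = x} {y} {z} tx peak bound eq =
  subst (λ s → Trit (x + s)) (sym (sgnNext≡sgnAt-reverse d))
    (trit-push (reverse d) tx λ x≡s →
      overshoot {y = y} peak bound (trans (balance-right {x} {y} {z} eq)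
        (trans (cong (λ t → z - t) x≡s) (minus-reverse d z))))

-- |p − q| ≤ p + q, strictly when both p and q are positive: a path using both
-- ←s_k and →s_k crosses edge k more often than its net flow requires
cancel-≤ : ∀ p q → ∣ + p - + q ∣ ≤ p ℕ.+ q
cancel-≤ p q = ℤP.∣i-j∣≤∣i∣+∣j∣ (+ p) (+ q)

cancel-< : ∀ p q → 0 < p → 0 < q → ∣ + p - + q ∣ < p ℕ.+ q
cancel-< (suc p) (suc q) _ _ = begin-strict
  ∣ suc p ⊖ suc q ∣  ≡⟨ cong ∣_∣ (ℤP.[1+m]⊖[1+n]≡m⊖n p q) ⟩
  ∣ p ⊖ q ∣          ≡⟨ cong ∣_∣ (sym (ℤP.m-n≡m⊖n p q)) ⟩
  ∣ + p - + q ∣      ≤⟨ cancel-≤ p q ⟩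
  p ℕ.+ q            <⟨ s≤s (ℕP.+-monoʳ-≤ p (ℕP.n≤1+n q)) ⟩
  suc p ℕ.+ suc q    ∎
  where open ℕP.≤-Reasoning

∣-zero : ∀ k → k ℤD.∣ + 0
∣-zero k = ℕD._∣0 ∣ k ∣

∣-+ : ∀ k a b → k ℤD.∣ a → k ℤD.∣ b → k ℤD.∣ (a + b)
∣-+ k a b k∣a k∣b =
  ℤS.∣⇒∣ᵤ {k} {a + b}
    (ℤS.∣m∣n⇒∣m+n (ℤS.∣ᵤ⇒∣ {k} {a} k∣a) (ℤS.∣ᵤ⇒∣ {k} {b} k∣b))

∣-neg : ∀ k a → k ℤD.∣ a → k ℤD.∣ (- a)
∣-neg k a k∣a = subst (∣ k ∣ ℕD.∣_) (sym (ℤP.∣-i∣≡∣i∣ a)) k∣a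

small-multiple : ∀ {n x} → + 0 ℤ.≤ x → x ℤ.< + n → + n ℤD.∣ x → x ≡ + 0
small-multiple {x = + zero}  _ _ _ = refl
small-multiple {x = +[1+ k ]} _ (ℤ.+<+ k<n) n∣x = ⊥-elim (ℕD.>⇒∤ k<n n∣x)

the-other : ∀ {p q} → p ≡ 0 ⊎ q ≡ 0 → p ≢ 0 → q ≡ 0
the-other (inj₁ p≡0) p≢0 = ⊥-elim (p≢0 p≡0)
the-other (inj₂ q≡0) _   = q≡0

net-positive : ∀ {p q} → p ≢ 0 → q ≡ 0 → ∃[ a ] + p - + q ≡ + suc a
net-positive {zero}  p≢0 _    = ⊥-elim (p≢0 refl)
net-positive {suc p} _   refl = p ℕ.+ 0 , refl

net-negative : ∀ {p q} → p ≡ 0 → q ≢ 0 → ∃[ b ] + p - + q ≡ -[1+ b ]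
net-negative {q = zero}  _    q≢0 = ⊥-elim (q≢0 refl)
net-negative {q = suc q} refl _   = q , refl

net-zero : ∀ {p q} → p ≡ 0 ⊎ q ≡ 0 → + p - + q ≡ + 0 → p ≡ 0 × q ≡ 0
net-zero {q = zero}  (inj₁ refl) _   = refl , refl
net-zero {q = suc q} (inj₁ refl) ()
net-zero {p}         (inj₂ refl) net = ℕP.m+n≡0⇒m≡0 p (ℤP.+-injective net) , refl

positive-plus-trit : ∀ a {x} → Trit x → + suc a + x ≡ + 0 ⊎ ∃[ a' ] + suc a + x ≡ + suc a'
positive-plus-trit zero    (inj₁ refl)        = inj₁ refl
positive-plus-trit (suc a) (inj₁ refl)        = inj₂ (a , refl)
positive-plus-trit a       (inj₂ (inj₁ refl)) = inj₂ (a ℕ.+ 0 , refl)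
positive-plus-trit a       (inj₂ (inj₂ refl)) = inj₂ (a ℕ.+ 1 , refl)

positive-step : ∀ a y → Trit (y - + suc a) → y ≡ + 0 ⊎ ∃[ a' ] y ≡ + suc a'
positive-step a y trit =
  map (trans recompose) (λ (a' , e) → a' , trans recompose e) (positive-plus-trit a trit)
  where
  identity : ∀ y x → y ≡ x + (y - x)
  identity = solve-∀
  recompose : y ≡ + suc a + (y - + suc a)
  recompose = identity y (+ suc a)

discrete-ivt : ∀ (f : ℕ → ℤ) M → (∀ k → k < M → Trit (f (suc k) - f k)) →
               ∀ {a b} → f 0 ≡ + suc a → f M ≡ -[1+ b ] → ∃[ k ] k ≤ M × f k ≡ + 0
discrete-ivt f M steps {a} f0 fM with scan M ℕP.≤-refl
  where
  scan : ∀ K → K ≤ M → (∃[ k ] k ≤ K × f k ≡ + 0) ⊎ (∃[ a' ] f K ≡ + suc a')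
  scan zero    _   = inj₂ (a , f0)
  scan (suc K) K<M with scan K (ℕP.<⇒≤ K<M)
  ... | inj₁ (k , k≤K , fk≡0) = inj₁ (k , ℕP.m≤n⇒m≤1+n k≤K , fk≡0)
  ... | inj₂ (a' , fK) =
    map₁ (λ hit → suc K , ℕP.≤-refl , hit)
         (positive-step a' (f (suc K)) (subst (λ t → Trit (f (suc K) - t)) fK (steps K K<M)))
... | inj₁ crossing  = crossing
... | inj₂ (_ , fM-positive) with trans (sym fM-positive) fM
...   | ()

prev : ℤ → (ℕ → ℤ) → ℕ → ℤ
prev b c zero    = b
prev b c (suc k) = c k

prev-shift : ∀ b c k → prev (c 0) (c ∘ suc) k ≡ prev b c (suc k)
prev-shift b c zero    = refl
prev-shift b c (suc k) = refl

prev-adjust : ∀ b c i g k → k ≢ suc i → prev b (adjust c i g) k ≡ prev b c k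
prev-adjust b c i g zero    _        = refl
prev-adjust b c i g (suc k) k≢1+i = adjust-there c i g (k≢1+i ∘ cong suc)

divergence : (ℕ → ℤ) → ℕ → ℤ
divergence c k = c k - prev (+ 0) c k

dipole : ℕ → ℤ → ℕ → ℤ
dipole i s k with k ℕ.≟ i | k ℕ.≟ suc i
... | yes _ | _     = s
... | no _  | yes _ = - s
... | no _  | no _  = + 0

delta≡dipole : ∀ {m} (i : Fin (suc m)) d (j : Fin (suc (suc m))) →
               delta (i , d) j ≡ dipole (toℕ i) (sgnAt d) (toℕ j)
delta≡dipole i d j with toℕ j ℕ.≟ toℕ i | toℕ j ℕ.≟ suc (toℕ i)
... | yes _ | _     = refl
... | no _  | yes _ = sgnNext≡-sgnAt d
  where
  sgnNext≡-sgnAt : ∀ d → sgnNext d ≡ - sgnAt d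
  sgnNext≡-sgnAt L = refl
  sgnNext≡-sgnAt R = refl
... | no _  | no _  = refl

dipole-neg : ∀ i s k → dipole i (- s) k ≡ - dipole i s k
dipole-neg i s k with k ℕ.≟ i | k ℕ.≟ suc i
... | yes _ | _     = refl
... | no _  | yes _ = refl
... | no _  | no _  = refl

divergence-adjust : ∀ c i s k →
                    divergence (adjust c i (λ x → x + s)) k ≡ divergence c k + dipole i s k
divergence-adjust c i s k with k ℕ.≟ i | k ℕ.≟ suc i
... | yes refl | _ =
  trans (cong (λ t → (c k + s) - t) (prev-adjust (+ 0) c k (λ x → x + s) k (λ ())))
        (identity (c k) (prev (+ 0) c k) s)
  where
  identity : ∀ a b s → (a + s) - b ≡ (a - b) + s
  identity = solve-∀
... | no _ | yes refl =
  trans (cong (λ t → c (suc i) - t) (adjust-here c i (λ x → x + s)))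
        (identity (c (suc i)) (c i) s)
  where
  identity : ∀ a b s → a - (b + s) ≡ (a - b) + - s
  identity = solve-∀
... | no _ | no k≢1+i =
  trans (cong (λ t → c k - t) (prev-adjust (+ 0) c i (λ x → x + s) k k≢1+i))
        (sym (ℤP.+-identityʳ _))

gain loss : (ℕ → ℤ) → ℕ → Dir → ℕ → ℤ
gain c i d = adjust c i (λ x → x + sgnAt d)
loss c i d = adjust c i (λ x → x - sgnAt d)

divergence-vanishing : ∀ c K → (∀ k → k ≤ K → c k ≡ + 0) →
                       ∀ k → k ≤ K → divergence c k ≡ + 0
divergence-vanishing c K c≡0 zero    0≤K   = cong (λ t → t - + 0) (c≡0 0 0≤K)
divergence-vanishing c K c≡0 (suc k) 1+k≤K =
  cong₂ _-_ (c≡0 (suc k) 1+k≤K) (c≡0 k (ℕP.≤-trans (ℕP.n≤1+n k) 1+k≤K))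

divergence-cong : ∀ {c c'} → (∀ k → c k ≡ c' k) → ∀ k → divergence c k ≡ divergence c' k
divergence-cong c≗c' zero    = cong (λ t → t - + 0) (c≗c' 0)
divergence-cong c≗c' (suc k) = cong₂ _-_ (c≗c' (suc k)) (c≗c' k)

module _ (n m : ℕ) where

  beyond-edges : (i : Fin (suc m)) → suc m ≢ toℕ i
  beyond-edges i m+1≡i = ℕP.<-irrefl (sym m+1≡i) (FP.toℕ<n i)

  loss-end : ∀ c (i : Fin (suc m)) d → c (suc m) ≡ + 0 → loss c (toℕ i) d (suc m) ≡ + 0
  loss-end c i d c-end≡0 = trans (adjust-there c (toℕ i) _ (beyond-edges i)) c-end≡0

  boundary? : ∀ j → Dec (Boundary m j)
  boundary? j = (toℕ j ℕ.≟ 0) ⊎-dec (toℕ j ℕ.≟ suc m)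

  eqAt-refl : ∀ {j a b} → a ≡ b → EqAt n m j a b
  eqAt-refl {j} {a} refl with boundary? j
  ... | yes bd = inj₁ (bd , subst (+ n ℤD.∣_) (sym (ℤP.+-inverseʳ a)) (∣-zero (+ n)))
  ... | no nb  = inj₂ (nb , refl)

  eqAt-sym : ∀ {j a b} → EqAt n m j a b → EqAt n m j b a
  eqAt-sym {a = a} {b} (inj₁ (bd , n∣a-b)) =
    inj₁ (bd , subst (+ n ℤD.∣_) (identity a b) (∣-neg (+ n) (a - b) n∣a-b))
    where
    identity : ∀ a b → - (a - b) ≡ b - a
    identity = solve-∀
  eqAt-sym (inj₂ (nb , refl)) = inj₂ (nb , refl)

  eqAt-trans : ∀ {j a b c} → EqAt n m j a b → EqAt n m j b c → EqAt n m j a c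
  eqAt-trans {a = a} {b} {c} (inj₁ (bd , n∣a-b)) (inj₁ (_ , n∣b-c)) =
    inj₁ (bd , subst (+ n ℤD.∣_) (identity a b c) (∣-+ (+ n) (a - b) (b - c) n∣a-b n∣b-c))
    where
    identity : ∀ a b c → (a - b) + (b - c) ≡ a - c
    identity = solve-∀
  eqAt-trans (inj₁ (bd , _)) (inj₂ (nb , _)) = ⊥-elim (nb bd)
  eqAt-trans (inj₂ (nb , _)) (inj₁ (bd , _)) = ⊥-elim (nb bd)
  eqAt-trans (inj₂ (nb , refl)) (inj₂ (_ , refl)) = inj₂ (nb , refl)

  eqAt-+ : ∀ {j a b} x → EqAt n m j a b → EqAt n m j (a + x) (b + x)
  eqAt-+ {a = a} {b} x (inj₁ (bd , n∣a-b)) =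
    inj₁ (bd , subst (+ n ℤD.∣_) (identity a b x) n∣a-b)
    where
    identity : ∀ a b x → a - b ≡ (a + x) - (b + x)
    identity = solve-∀
  eqAt-+ x (inj₂ (nb , refl)) = inj₂ (nb , refl)

  eqAt-zero : ∀ {j x} → EqAt n m j (+ 0) x → + n ℤD.∣ x
  eqAt-zero {x = x} (inj₁ (_ , n∣0-x)) =
    subst (+ n ℤD.∣_) (identity x) (∣-neg (+ n) (+ 0 - x) n∣0-x)
    where
    identity : ∀ x → - (+ 0 - x) ≡ x
    identity = solve-∀
  eqAt-zero (inj₂ (_ , refl)) = ∣-zero (+ n)

  Flow : Tuple m → (ℕ → ℤ) → Set
  Flow u c = ∀ j → EqAt n m j (+ 0) (lookup u j + divergence c (toℕ j))

  flow-inner : ∀ {u c} → Flow u c → ∀ j → ¬ Boundary m j →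
               + 0 ≡ lookup u j + divergence c (toℕ j)
  flow-inner fl j nb with fl j
  ... | inj₁ (bd , _) = ⊥-elim (nb bd)
  ... | inj₂ (_ , eq) = eq

  flow-cong : ∀ {u c c'} → (∀ k → c k ≡ c' k) → Flow u c → Flow u c'
  flow-cong {u} c≗c' fl j =
    subst (λ t → EqAt n m j (+ 0) (lookup u j + t)) (divergence-cong c≗c' (toℕ j)) (fl j)

  Shift : Gen m → Tuple m → Tuple m → Set
  Shift g u u' = ∀ j → EqAt n m j (lookup u' j) (lookup u j + delta g j)

  flow-back : ∀ {u u' c} {i : Fin (suc m)} {d} → Shift (i , d) u u' → Flow u' c →
              Flow u (gain c (toℕ i) d)
  flow-back {u} {u'} {c} {i} {d} shift fl j =
    eqAt-trans (fl j) (eqAt-trans (eqAt-+ (divergence c k) (shift j)) (eqAt-refl regroup))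
    where
    k : ℕ
    k = toℕ j
    δ : ℤ
    δ = delta (i , d) j
    regroup : (lookup u j + δ) + divergence c k ≡ lookup u j + divergence (gain c (toℕ i) d) k
    regroup = begin
      (lookup u j + δ) + divergence c k
        ≡⟨ identity (lookup u j) δ (divergence c k) ⟩
      lookup u j + (divergence c k + δ)
        ≡⟨ cong (λ t → lookup u j + (divergence c k + t)) (delta≡dipole i d j) ⟩
      lookup u j + (divergence c k + dipole (toℕ i) (sgnAt d) k)
        ≡⟨ cong (λ t → lookup u j + t) (sym (divergence-adjust c (toℕ i) (sgnAt d) k)) ⟩
      lookup u j + divergence (gain c (toℕ i) d) k ∎
      where
      open ≡-Reasoning
      identity : ∀ u δ e → (u + δ) + e ≡ u + (e + δ)
      identity = solve-∀

  flow-forward : ∀ {u u' c} {i : Fin (suc m)} {d} → Shift (i , d) u u' → Flow u c →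
                 Flow u' (loss c (toℕ i) d)
  flow-forward {u} {u'} {c} {i} {d} shift fl j =
    eqAt-trans (fl j) (eqAt-trans (eqAt-refl regroup)
      (eqAt-trans (eqAt-+ (divergence c k - δ) (eqAt-sym (shift j))) (eqAt-refl regroup')))
    where
    k : ℕ
    k = toℕ j
    δ : ℤ
    δ = delta (i , d) j
    regroup : lookup u j + divergence c k ≡ (lookup u j + δ) + (divergence c k - δ)
    regroup = identity (lookup u j) δ (divergence c k)
      where
      identity : ∀ u δ e → u + e ≡ (u + δ) + (e - δ)
      identity = solve-∀
    regroup' : lookup u' j + (divergence c k - δ) ≡ lookup u' j + divergence (loss c (toℕ i) d) k
    regroup' = cong (λ t → lookup u' j + t) (begin
      divergence c k - δ
        ≡⟨ cong (λ t → divergence c k - t) (delta≡dipole i d j) ⟩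
      divergence c k - dipole (toℕ i) (sgnAt d) k
        ≡⟨ cong (λ t → divergence c k + t) (sym (dipole-neg (toℕ i) (sgnAt d) k)) ⟩
      divergence c k + dipole (toℕ i) (- sgnAt d) k
        ≡⟨ sym (divergence-adjust c (toℕ i) (- sgnAt d) k) ⟩
      divergence (loss c (toℕ i) d) k ∎)
      where open ≡-Reasoning

  telescope : ∀ {K} (u : Vec ℤ K) b c →
              (∀ j → + n ℤD.∣ (lookup u j + (c (toℕ j) - prev b c (toℕ j)))) →
              + n ℤD.∣ (sumℤ u + (prev b c K - b))
  telescope [] b c _ = subst (+ n ℤD.∣_) (identity b) (∣-zero (+ n))
    where
    identity : ∀ b → + 0 ≡ + 0 + (b - b)
    identity = solve-∀
  telescope {suc K} (x ∷ u) b c each =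
    subst (+ n ℤD.∣_) regroup (∣-+ (+ n) head rest (each F.zero) (telescope u (c 0) (c ∘ suc) each'))
    where
    head rest : ℤ
    head = x + (c 0 - b)
    rest = sumℤ u + (prev (c 0) (c ∘ suc) K - c 0)
    each' : ∀ j → + n ℤD.∣ (lookup u j + (c (suc (toℕ j)) - prev (c 0) (c ∘ suc) (toℕ j)))
    each' j = subst (λ t → + n ℤD.∣ (lookup u j + (c (suc (toℕ j)) - t)))
                    (sym (prev-shift b c (toℕ j))) (each (F.suc j))
    regroup : head + rest ≡ (x + sumℤ u) + (prev b c (suc K) - b)
    regroup = trans (cong (λ t → (x + (c 0 - b)) + (sumℤ u + (t - c 0))) (prev-shift b c K))
                    (identity x (sumℤ u) (c K) b (c 0))
      where
      identity : ∀ x s z b a → (x + (a - b)) + (s + (z - a)) ≡ (x + s) + (z - b)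
      identity = solve-∀

  flow-sum : ∀ {u c} → Flow u c → c (suc m) ≡ + 0 → + n ℤD.∣ sumℤ u
  flow-sum {u} {c} fl c-end≡0 =
    subst (+ n ℤD.∣_) total (telescope u (+ 0) c (λ j → eqAt-zero (fl j)))
    where
    total : sumℤ u + (c (suc m) - + 0) ≡ sumℤ u
    total = trans (cong (λ t → sumℤ u + (t - + 0)) c-end≡0) (ℤP.+-identityʳ (sumℤ u))

  flow-zero : ∀ {u c} → IsVertex n m u → Flow u c → (∀ k → k ≤ suc m → c k ≡ + 0) → u ≡ zeroV m
  flow-zero {u} {c} vu fl c≡0 =
    trans (sym (VP.tabulate∘lookup u))
          (trans (VP.tabulate-cong coordinate) (VP.tabulate∘lookup (zeroV m)))
    where
    settled : ∀ j → lookup u j + divergence c (toℕ j) ≡ lookup u j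
    settled j = trans (cong (λ t → lookup u j + t)
                        (divergence-vanishing c (suc m) c≡0 (toℕ j) (ℕP.≤-pred (FP.toℕ<n j))))
                      (ℤP.+-identityʳ (lookup u j))
    coordinate : ∀ j → lookup u j ≡ lookup (zeroV m) j
    coordinate j with fl j
    ... | inj₁ (bd , _) = trans (small-multiple {n} (proj₁ range) (proj₂ range)
                                   (subst (+ n ℤD.∣_) (settled j) (eqAt-zero (fl j))))
                                (sym (VP.lookup-replicate j (+ 0)))
      where
      range : (+ 0 ℤ.≤ lookup u j) × (lookup u j ℤ.< + n)
      range = IsVertex.boundaryRange vu j bd
    ... | inj₂ (_ , 0≡u) = trans (sym (trans 0≡u (settled j))) (sym (VP.lookup-replicate j (+ 0)))

  -- between consecutive edges k, k+1 a flow changes by −u_{k+1} ∈ {−1,0,1}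
  flow-steps : ∀ {u c} → IsVertex n m u → Flow u c → ∀ k → k < m → Trit (c (suc k) - c k)
  flow-steps {u} {c} vu fl k k<m =
    subst Trit (sym solved) (trit-neg (IsVertex.innerRange vu j inner-j))
    where
    j : Fin (suc (suc m))
    j = F.suc (F.fromℕ< (s≤s (ℕP.<⇒≤ k<m)))
    toℕ-j : toℕ j ≡ suc k
    toℕ-j = cong suc (FP.toℕ-fromℕ< (s≤s (ℕP.<⇒≤ k<m)))
    inner-j : ¬ Boundary m j
    inner-j (inj₁ ())
    inner-j (inj₂ j≡1+m) = ℕP.<-irrefl (ℕP.suc-injective (trans (sym toℕ-j) j≡1+m)) k<m
    balance : + 0 ≡ lookup u j + (c (suc k) - c k)
    balance = subst (λ t → + 0 ≡ lookup u j + divergence c t) toℕ-j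
                    (flow-inner {u} {c} fl j inner-j)
    solved : c (suc k) - c k ≡ - lookup u j
    solved = begin
      c (suc k) - c k                                  ≡⟨ identity (lookup u j) (c (suc k) - c k) ⟩
      (lookup u j + (c (suc k) - c k)) - lookup u j    ≡⟨ cong (λ t → t - lookup u j) (sym balance) ⟩
      + 0 - lookup u j                                 ≡⟨ ℤP.+-identityˡ _ ⟩
      - lookup u j                                     ∎
      where
      open ≡-Reasoning
      identity : ∀ x y → y ≡ (x + y) - x
      identity = solve-∀

  occ : ∀ {u w} → Dir → Path n m u w → ℕ → ℕ
  occ d []                  = λ _ → 0
  occ d (step (i , d') _ P) = tally d' d (occ d P) (toℕ i)

  occ-member : ∀ {u w} (P : Path n m u w) i d → (i , d) ∈ word P → 0 < occ d P (toℕ i)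
  occ-member (step _ _ P) i d (here refl) =
    subst (0 <_) (sym (tally-same d (occ d P) (toℕ i))) (s≤s z≤n)
  occ-member (step (i' , d') _ P) i d (there i∈P) =
    ℕP.<-≤-trans (occ-member P i d i∈P) (tally-mono d' d (occ d P) (toℕ i') (toℕ i))

  absent : ∀ {u w} (P : Path n m u w) i d → occ d P (toℕ i) ≡ 0 → ¬ ((i , d) ∈ word P)
  absent P i d occ≡0 i∈P = ℕP.<-irrefl (sym occ≡0) (occ-member P i d i∈P)

  occ-beyond : ∀ {u w} (P : Path n m u w) d → occ d P (suc m) ≡ 0
  occ-beyond []                  d = refl
  occ-beyond (step (i , d') _ P) d =
    trans (tally-there d' d (occ d P) (toℕ i) (beyond-edges i)) (occ-beyond P d)

  uses : ∀ {u w} → Path n m u w → ℕ → ℕ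
  uses P k = occ L P k ℕ.+ occ R P k

  uses-step-here : ∀ {u u' w} i d (mv : Move n m (i , d) u u') (P : Path n m u' w) →
                   uses (step (i , d) mv P) (toℕ i) ≡ suc (uses P (toℕ i))
  uses-step-here i L mv P = cong (ℕ._+ occ R P (toℕ i)) (tally-same L (occ L P) (toℕ i))
  uses-step-here i R mv P =
    trans (cong (occ L P (toℕ i) ℕ.+_) (tally-same R (occ R P) (toℕ i))) (ℕP.+-suc _ _)

  uses-step-there : ∀ {u u' w} i d (mv : Move n m (i , d) u u') (P : Path n m u' w) k →
                    k ≢ toℕ i → uses (step (i , d) mv P) k ≡ uses P k
  uses-step-there i d mv P k k≢i =
    cong₂ ℕ._+_ (tally-there d L (occ L P) (toℕ i) k≢i) (tally-there d R (occ R P) (toℕ i) k≢i)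

  len≡uses : ∀ {u w} (P : Path n m u w) → len P ≡ sumBelow (suc m) (uses P)
  len≡uses []                  = sym (sumBelow-zero (suc m) (uses {w = zeroV m} []) (λ _ _ → refl))
  len≡uses (step (i , d) mv P) =
    trans (cong suc (len≡uses P))
          (sym (sumBelow-bump (suc m) (uses P) (uses (step (i , d) mv P)) (toℕ i) (FP.toℕ<n i)
                 (uses-step-here i d mv P) (uses-step-there i d mv P)))

  netFlow : ∀ {u w} → Path n m u w → ℕ → ℤ
  netFlow P k = + occ L P k - + occ R P k

  netFlow-step : ∀ {u u' w} i d (mv : Move n m (i , d) u u') (P : Path n m u' w) k →
                 netFlow (step (i , d) mv P) k ≡ gain (netFlow P) (toℕ i) d k
  netFlow-step i L mv P k with k ℕ.≟ toℕ i
  ... | yes _ = identity (+ occ L P k) (+ occ R P k)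
    where
    identity : ∀ x y → (+ 1 + x) - y ≡ (x - y) + + 1
    identity = solve-∀
  ... | no _  = refl
  netFlow-step i R mv P k with k ℕ.≟ toℕ i
  ... | yes _ = identity (+ occ L P k) (+ occ R P k)
    where
    identity : ∀ x y → x - (+ 1 + y) ≡ (x - y) + - (+ 1)
    identity = solve-∀
  ... | no _  = refl

  netFlow-end : ∀ {u w} (P : Path n m u w) → netFlow P (suc m) ≡ + 0
  netFlow-end P = cong₂ (λ p q → + p - + q) (occ-beyond P L) (occ-beyond P R)

  pathFlow : ∀ {v} (P : Path n m v (zeroV m)) → Flow v (netFlow P)
  pathFlow [] j = eqAt-refl (sym (begin
    lookup (zeroV m) j + divergence (λ _ → + 0) (toℕ j)
      ≡⟨ cong₂ _+_ (VP.lookup-replicate j (+ 0))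
                   (divergence-vanishing (λ _ → + 0) (toℕ j) (λ _ _ → refl) (toℕ j) ℕP.≤-refl) ⟩
    + 0 ∎))
    where open ≡-Reasoning
  pathFlow {v} (step {u' = u'} (i , d) mv P) =
    flow-cong {v} (λ k → sym (netFlow-step i d mv P k))
              (flow-back {v} {u'} {netFlow P} {i} {d} (Move.shift mv) (pathFlow P))

  module _ {{_ : NonZero n}} where

    normalise : Fin (suc (suc m)) → ℤ → ℤ
    normalise j x with boundary? j
    ... | yes _ = + (x %ℕ n)
    ... | no _  = x

    normalise-eqAt : ∀ j x → EqAt n m j (normalise j x) x
    normalise-eqAt j x with boundary? j
    ... | yes bd = inj₁ (bd , ℤS.∣⇒∣ᵤ {+ n} {+ (x %ℕ n) - x} (ℤS.divides (- (x /ℕ n)) remainder))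
      where
      identity : ∀ r q k → r - (r + q * k) ≡ (- q) * k
      identity = solve-∀
      remainder : + (x %ℕ n) - x ≡ (- (x /ℕ n)) * + n
      remainder = trans (cong (λ t → + (x %ℕ n) - t) (a≡a%ℕn+[a/ℕn]*n x n))
                        (identity (+ (x %ℕ n)) (x /ℕ n) (+ n))
    ... | no nb  = inj₂ (nb , refl)

    normalise-range : ∀ j x → Boundary m j → (+ 0 ℤ.≤ normalise j x) × (normalise j x ℤ.< + n)
    normalise-range j x bd with boundary? j
    ... | yes _ = ℤ.+≤+ z≤n , ℤ.+<+ (n%ℕd<d x n)
    ... | no nb = ⊥-elim (nb bd)

    normalise-inner : ∀ j x → ¬ Boundary m j → normalise j x ≡ x
    normalise-inner j x nb with boundary? j
    ... | yes bd = ⊥-elim (nb bd)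
    ... | no _   = refl

    descend : ∀ {u c} (i : Fin (suc m)) {d a} → IsVertex n m u → Flow u c → c (suc m) ≡ + 0 →
              Oriented d a (c (toℕ i)) → (∀ k → k ≤ m → ∣ c k ∣ ≤ suc a) →
              Σ (Tuple m) λ u' → Move n m (i , d) u u' × Flow u' (loss c (toℕ i) d)
    descend {u} {c} i {d} {a} vu fl c-end≡0 peak below = u' , move , flow'
      where
      u' : Tuple m
      u' = tabulate (λ j → normalise j (lookup u j + delta (i , d) j))

      u'-at : ∀ j → lookup u' j ≡ normalise j (lookup u j + delta (i , d) j)
      u'-at = VP.lookup∘tabulate _

      shift : Shift (i , d) u u'
      shift j = subst (λ t → EqAt n m j t (lookup u j + delta (i , d) j)) (sym (u'-at j))
                      (normalise-eqAt j _)

      flow' : Flow u' (loss c (toℕ i) d)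
      flow' = flow-forward {u} {u'} {c} {i} {d} shift fl

      bounded : ∀ k → k ≤ suc m → ∣ c k ∣ ≤ suc a
      bounded k k≤ with ℕP.m≤n⇒m<n∨m≡n k≤
      ... | inj₁ k<   = below k (ℕP.≤-pred k<)
      ... | inj₂ refl = subst (λ t → ∣ t ∣ ≤ suc a) (sym c-end≡0) z≤n

      prev-bounded : ∀ k → k ≤ suc m → ∣ prev (+ 0) c k ∣ ≤ suc a
      prev-bounded zero    _   = z≤n
      prev-bounded (suc k) k< = bounded k (ℕP.≤-trans (ℕP.n≤1+n k) k<)

      j≤ : ∀ j → toℕ j ≤ suc m
      j≤ j = ℕP.≤-pred (FP.toℕ<n j)

      -- the moved inner coordinates stay in {−1,0,1}, by maximality of |c(i)|
      moved-inner : ∀ j → ¬ Boundary m j → Trit (lookup u j + delta (i , d) j)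
      moved-inner j nb with toℕ j ℕ.≟ toℕ i | toℕ j ℕ.≟ suc (toℕ i)
      ... | yes j≡i | _ =
        push-at-source {z = prev (+ 0) c (toℕ j)} (IsVertex.innerRange vu j nb)
          (subst (λ k → Oriented d a (c k)) (sym j≡i) peak) (prev-bounded (toℕ j) (j≤ j))
          (flow-inner {u} {c} fl j nb)
      ... | no _ | yes j≡1+i =
        push-at-target {y = c (toℕ j)} {z = c (toℕ i)} (IsVertex.innerRange vu j nb) peak
          (bounded (toℕ j) (j≤ j))
          (subst (λ t → + 0 ≡ lookup u j + (c (toℕ j) - prev (+ 0) c t)) j≡1+i
                 (flow-inner {u} {c} fl j nb))
      ... | no _ | no _ = subst Trit (sym (ℤP.+-identityʳ _)) (IsVertex.innerRange vu j nb)

      vertex' : IsVertex n m u'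
      vertex' = record
        { boundaryRange = λ j bd → subst (λ t → (+ 0 ℤ.≤ t) × (t ℤ.< + n)) (sym (u'-at j))
                                         (normalise-range j _ bd)
        ; innerRange    = λ j nb → subst Trit (sym (trans (u'-at j) (normalise-inner j _ nb)))
                                         (moved-inner j nb)
        ; sumZero       = flow-sum {u'} {loss c (toℕ i) d} flow' (loss-end c i d c-end≡0)
        }

      move : Move n m (i , d) u u'
      move = record { srcVertex = vu ; tgtVertex = vertex' ; shift = shift }

    weight : (ℕ → ℤ) → ℕ
    weight c = sumBelow (suc m) (λ k → ∣ c k ∣)

    weight-descend : ∀ c (i : Fin (suc m)) {d a} → Oriented d a (c (toℕ i)) →
                     weight c ≡ suc (weight (loss c (toℕ i) d))
    weight-descend c i {d} peak =
      sumBelow-bump (suc m) (λ k → ∣ loss c (toℕ i) d k ∣) (λ k → ∣ c k ∣) (toℕ i) (FP.toℕ<n i)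
        (trans (oriented-toward peak) (cong (λ t → suc ∣ t ∣) (sym (adjust-here c (toℕ i) _))))
        (λ k k≢i → cong ∣_∣ (sym (adjust-there c (toℕ i) _ k≢i)))

    realise : ∀ N {u c} → IsVertex n m u → Flow u c → c (suc m) ≡ + 0 → weight c ≡ N →
              Σ (Path n m u (zeroV m)) λ Q → len Q ≡ N
    realise zero {u} {c} vu fl c-end≡0 weight≡0 = at-zero (flow-zero {u} {c} vu fl vanishing)
      where
      at-zero : ∀ {u} → u ≡ zeroV m → Σ (Path n m u (zeroV m)) λ Q → len Q ≡ 0
      at-zero refl = [] , refl
      vanishing : ∀ k → k ≤ suc m → c k ≡ + 0
      vanishing k k≤ with ℕP.m≤n⇒m<n∨m≡n k≤
      ... | inj₁ k<   = ℤP.∣i∣≡0⇒i≡0 (sumBelow≡0 (suc m) (λ k → ∣ c k ∣) weight≡0 k k<)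
      ... | inj₂ refl = c-end≡0
    realise (suc N) {u} {c} vu fl c-end≡0 weight≡1+N with argmax (λ k → ∣ c k ∣) m
    ... | i , maximal = continue (orient (c (toℕ i)))
      where
      continue : c (toℕ i) ≡ + 0 ⊎ (Σ Dir λ d → Σ ℕ λ a → Oriented d a (c (toℕ i))) →
                 Σ (Path n m u (zeroV m)) λ Q → len Q ≡ suc N
      continue (inj₁ ci≡0) = ⊥-elim (ℕP.1+n≢0 (trans (sym weight≡1+N) weight≡0))
        where
        weight≡0 : weight c ≡ 0
        weight≡0 = sumBelow-zero (suc m) _ λ k k< →
          ℕP.n≤0⇒n≡0 (subst (λ t → ∣ c k ∣ ≤ ∣ t ∣) ci≡0 (maximal k (ℕP.≤-pred k<)))
      continue (inj₂ (d , a , peak)) =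
        let (u' , mv , fl') = descend {u} {c} i vu fl c-end≡0 peak below
            (Q , lenQ)      = realise N {u'} {loss c (toℕ i) d} (Move.tgtVertex mv) fl'
                                (loss-end c i d c-end≡0) weight'
        in step (i , d) mv Q , cong suc lenQ
        where
        below : ∀ k → k ≤ m → ∣ c k ∣ ≤ suc a
        below k k≤ = subst (∣ c k ∣ ≤_) (oriented-size peak) (maximal k k≤)
        weight' : weight (loss c (toℕ i) d) ≡ N
        weight' = ℕP.suc-injective (trans (sym (weight-descend c i peak)) weight≡1+N)

    geodesic-bound : ∀ {v} → IsVertex n m v → (P : Path n m v (zeroV m)) → IsGeodesic P →
                     len P ≤ weight (netFlow P)
    geodesic-bound {v} vv P geo =
      let (Q , lenQ) = realise _ {v} {netFlow P} vv (pathFlow P) (netFlow-end P) refl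
      in subst (len P ≤_) lenQ (geo Q)

    no-cancellation : ∀ {v} → IsVertex n m v → (P : Path n m v (zeroV m)) → IsGeodesic P →
                      ∀ k → k ≤ m → occ L P k ≡ 0 ⊎ occ R P k ≡ 0
    no-cancellation vv P geo k k≤m with occ L P k ℕ.≟ 0 | occ R P k ℕ.≟ 0
    ... | yes none | _        = inj₁ none
    ... | no _     | yes none = inj₂ none
    ... | no someL | no someR = ⊥-elim (ℕP.<-irrefl refl (begin-strict
      weight (netFlow P)            <⟨ sumBelow-strict (suc m) _ (uses P) k (s≤s k≤m)
                                         (cancel-< _ _ (ℕP.n≢0⇒n>0 someL) (ℕP.n≢0⇒n>0 someR))
                                         (λ k → cancel-≤ (occ L P k) (occ R P k)) ⟩
      sumBelow (suc m) (uses P)     ≡⟨ sym (len≡uses P) ⟩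
      len P                         ≤⟨ geodesic-bound vv P geo ⟩
      weight (netFlow P)            ∎))
      where open ℕP.≤-Reasoning

    -- Every geodesic has a wall: −1 or m+1 if ←s_0 or →s_m is unused, and
    -- otherwise an inner edge where the net flow crosses from positive to negative.
    geodesic-wall : ∀ {v} → IsVertex n m v → (P : Path n m v (zeroV m)) → IsGeodesic P →
                    Σ (WallPos m) (IsWall P)
    geodesic-wall {v} vv P geo with occ L P 0 ℕ.≟ 0 | occ R P m ℕ.≟ 0
    ... | yes unusedFirst | _ = minus1 , absent P F.zero L unusedFirst
    ... | no _ | yes unusedLast =
      mplus1 , absent P (F.fromℕ m) R (trans (cong (occ R P) (FP.toℕ-fromℕ m)) unusedLast)
    ... | no usedFirst | no usedLast =
      let exclusive            = no-cancellation vv P geo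
          (_ , first)          = net-positive usedFirst (the-other (exclusive 0 z≤n) usedFirst)
          (_ , last)           = net-negative (the-other (swap (exclusive m ℕP.≤-refl)) usedLast)
                                              usedLast
          steps                = flow-steps {v} {netFlow P} vv (pathFlow P)
          (k , k≤m , crossing) = discrete-ivt (netFlow P) m steps first last
      in inner (F.fromℕ< (s≤s k≤m)) , idle-wall k≤m (net-zero (exclusive k k≤m) crossing)
      where
      idle-wall : ∀ {k} (k≤m : k ≤ m) → occ L P k ≡ 0 × occ R P k ≡ 0 →
                  IsWall P (inner (F.fromℕ< (s≤s k≤m)))
      idle-wall k≤m (noL , noR) =
        absent P _ L (trans (cong (occ L P) (FP.toℕ-fromℕ< (s≤s k≤m))) noL) ,
        absent P _ R (trans (cong (occ R P) (FP.toℕ-fromℕ< (s≤s k≤m))) noR)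

geodesic-pivot : ∀ {n m v} (P : Path n m v (zeroV m)) → IsGeodesic P →
                 ∀ {p} → IsWall P p → IsPPivot P p
geodesic-pivot P geo wall = wall , λ Q _ → geo Q

lemma5p7 : (n m : ℕ) → 1 ≤ n → 1 ≤ m →
    (v : Tuple m) → IsVertex n m v →
    (P : Path n m v (zeroV m)) → IsGeodesic P → IsPivot P
lemma5p7 n m 1≤n _ v vv P geo =
  let (p , wall) = geodesic-wall n m {{>-nonZero 1≤n}} vv P geo
  in p , geodesic-pivot P geo wall
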